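{- Let $n\ge1$, $h\ge1$, $0\le\bar w\le n$, let $H$ be a multiset of $h$ binary strings each of length $n$ and weight $\bar w$, let $M=M(H)$, let $f$ be a cumulative weight function that is a solution to $M$, and let $m\in[2h]$. If there exist at least three maximal intervals between $f_m$ and $f_{m^*}$, then $|\mathcal{H}|>1$.
   Context: Notation: $[n]=\{1,\dots,n\}$; $[n_1,n_2]=\{n_1,\dots,n_2\}$ if $n_1\le n_2$, else $\emptyset$. For a binary string $t=t_1\cdots t_n$, $\mathrm{wt}(t)$ is its number of ones, $\overleftarrow{t}=t_n\cdots t_1$ its reversal, $t[l]$, $t[-l]$ its length-$l$ prefix and suffix; $M(t)$ is the multiset union of $\{(j-\mathrm{wt}(t[j]),\mathrm{wt}(t[j])) : j\in[n]\}$ and $\{(j-\mathrm{wt}(t[-j]),\mathrm{wt}(t[-j])) : j\in[n]\}$, and $M(U)$ is the multiset union of $M(t)$ over $t$ in a multiset $U$. Two multisets $U,V$ of strings satisfy $V\sim U$ if $|V|=|U|$ and for every string $t\in U$ the sum of the multiplicities of $t$ and $\overleftarrow{t}$ in $U$ equals that in $V$; $[U]$ is the equivalence class of $U$, and $\mathcal{H}=\{[U]: U\text{ a multiset of binary strings with } M(U)=M\}$. A cumulative weight function (CWF) is $f:\{0,\dots,n\}\times[2h]\to\{0,\dots,n\}$ with (a) $f(0,m)=0$; (b) $f(l,m)-f(l-1,m)\in\{0,1\}$ for $(l,m)\in[n]\times[2h]$; (c) for each $j\in[h]$ there is $w_j$ with $f(l,2j-1)+f(n-l,2j)=w_j$ for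 all $l\in\{0,\dots,n\}$. Write $f_m(l)=f(l,m)$; $m^*=m-1$ if $m$ is even, $m^*=m+1$ if $m$ is odd. $f$ is a solution to $M$ if $M=\{(l-f_m(l),f_m(l)): m\in[2h],l\in[n]\}$ as multisets. $D(m_1,m_2)=\{l\in[n]:f_{m_1}(l)\ne f_{m_2}(l)\}$; a nonempty $[k_1,k_2]\subset[n]$ is a maximal interval between $f_{m_1}$ and $f_{m_2}$ if $[k_1,k_2]\subset D(m_1,m_2)$ and $k_1-1,k_2+1\notin D(m_1,m_2)$. -}

module Defs where

open import Data.Nat using (ℕ; zero; suc; _+_; _*_; _∸_; _≤_)
open import Data.Bool using (Bool; true; false; if_then_else_)
open import Data.Bool.Properties using () renaming (_≟_ to _≟B_)
open import Data.List using (List; []; _∷_; map; concatMap; take; drop; length; upTo)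
open import Data.Vec using (Vec; toList; reverse)
open import Data.Vec.Properties using (≡-dec)
open import Data.Product using (_×_; _,_; Σ; ∃)
open import Data.Sum using (_⊎_)
open import Relation.Binary.PropositionalEquality using (_≡_; _≢_)
open import Relation.Nullary using (¬_; yes; no)
open import Data.List.Membership.Propositional using (_∈_)

BStr : ℕ → Set
BStr n = Vec Bool n

wtL : List Bool → ℕ
wtL [] = 0
wtL (true ∷ xs) = suc (wtL xs)
wtL (false ∷ xs) = wtL xs

wt : ∀ {n} → BStr n → ℕ
wt t = wtL (toList t)

oneTo : ℕ → List ℕ
oneTo n = map suc (upTo n)

prefixL : ℕ → List Bool → List Bool
prefixL j l = take j l

suffixL : ℕ → List Bool → List Bool
suffixL j l = drop (length l ∸ j) l

pt : List Bool → ℕ → ℕ × ℕ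
pt s j = (j ∸ wtL s , wtL s)

-- M(t), as a list (multiset up to permutation)
Mstr : ∀ {n} → BStr n → List (ℕ × ℕ)
Mstr {n} t = map (λ j → pt (prefixL j (toList t)) j) (oneTo n)
           Data.List.++ map (λ j → pt (suffixL j (toList t)) j) (oneTo n)

Mset : ∀ {n} → List (BStr n) → List (ℕ × ℕ)
Mset U = concatMap Mstr U

mult : ∀ {n} → BStr n → List (BStr n) → ℕ
mult t [] = 0
mult t (s ∷ U) with ≡-dec _≟B_ s t
... | yes _ = suc (mult t U)
... | no _ = mult t U

_∼_ : ∀ {n} → List (BStr n) → List (BStr n) → Set
_∼_ V U = length V ≡ length U ×
  (∀ t → t ∈ U → mult t U + mult (reverse t) U ≡ mult t V + mult (reverse t) V)

-- cumulative weight function  f : {0..n} × [2h] → {0..n}, written f l m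
IsCWF : ℕ → ℕ → (ℕ → ℕ → ℕ) → Set
IsCWF n h f =
  (∀ l m → l ≤ n → 1 ≤ m → m ≤ 2 * h → f l m ≤ n)
  × (∀ m → 1 ≤ m → m ≤ 2 * h → f 0 m ≡ 0)
  × (∀ l m → 1 ≤ l → l ≤ n → 1 ≤ m → m ≤ 2 * h →
       (f l m ≡ f (l ∸ 1) m) ⊎ (f l m ≡ suc (f (l ∸ 1) m)))
  × (∀ j → 1 ≤ j → j ≤ h → ∃ λ w → ∀ l → l ≤ n →
       f l (2 * j ∸ 1) + f (n ∸ l) (2 * j) ≡ w)

cwfMultiset : ℕ → ℕ → (ℕ → ℕ → ℕ) → List (ℕ × ℕ)
cwfMultiset n h f = concatMap (λ m → map (λ l → (l ∸ f l m , f l m)) (oneTo n)) (oneTo (2 * h))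

isEven : ℕ → Bool
isEven zero = true
isEven (suc zero) = false
isEven (suc (suc k)) = isEven k

star : ℕ → ℕ
star m = if isEven m then m ∸ 1 else suc m

InD : ℕ → (ℕ → ℕ → ℕ) → ℕ → ℕ → ℕ → Set
InD n f m₁ m₂ l = 1 ≤ l × l ≤ n × f l m₁ ≢ f l m₂

MaxInterval : ℕ → (ℕ → ℕ → ℕ) → ℕ → ℕ → ℕ → ℕ → Set
MaxInterval n f m₁ m₂ k₁ k₂ =
  1 ≤ k₁ × k₁ ≤ k₂ × k₂ ≤ n
  × (∀ l → k₁ ≤ l → l ≤ k₂ → InD n f m₁ m₂ l)
  × ¬ InD n f m₁ m₂ (k₁ ∸ 1)
  × ¬ InD n f m₁ m₂ (suc k₂)

-- A solution f assigns to the i-th pair of columns (2i+1, 2i+2) the string whose prefix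
-- weights are f_{2i+1} and whose suffix weights are f_{2i+2}; these h strings form a
-- multiset U with M(U) = M.  Maximal intervals between f_m and f_{m*} come in pairs
-- [a,b], [n-b,n-a] under l ↦ n-l.  Exchanging f_m and f_{m*} on one such pair gives a new
-- string c with the same M(c), since only the two halves of each point pair are swapped.
-- A third maximal interval, untouched by the exchange, shows that c is neither the old string
-- t nor its reversal, so replacing t by c lowers the number of copies of t and reversed t.
module Submission where

open import Defs
open import Data.Bool using (Bool; true; false; not)
open import Data.Bool.Properties using () renaming (_≟_ to _≟B_)
open import Data.Empty using (⊥-elim)
open import Data.List using (List; []; _∷_; _++_; map; take; drop; length; applyUpTo; concat; upTo)
import Data.List as List
open import Data.List.Properties
  using (++-assoc; take-all; map-∘; map-applyUpTo; map-cong-local; length-applyUpTo; length-drop;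
         length-reverse; take++drop≡id; reverse-++; unfold-reverse)
open import Data.List.Membership.Propositional.Properties using (∈-applyUpTo⁺)
open import Data.List.Relation.Unary.All using (All)
open import Data.List.Relation.Unary.All.Properties using (map⁺; applyUpTo⁺₁)
open import Data.List.Relation.Binary.Permutation.Propositional
  using (_↭_; ↭-refl; ↭-trans; ↭-sym; ↭-reflexive; prep; swap)
open import Data.List.Relation.Binary.Permutation.Propositional.Properties using (shift; ++⁺)
open import Data.Nat using (ℕ; zero; suc; _+_; _*_; _∸_; _≤_; _<_; z≤n; s≤s; pred; _≟_; _≤?_; _≡ᵇ_)
open import Data.Nat.Properties
open import Algebra.Properties.CommutativeSemigroup +-commutativeSemigroup using (interchange; x∙yz≈y∙xz)
open import Data.Product using (_×_; _,_; Σ; ∃; proj₁; proj₂)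
open import Data.Product.Properties using () renaming (≡-dec to ×-≡-dec)
open import Data.Sum using (_⊎_; inj₁; inj₂)
open import Data.Vec using (Vec; toList; reverse)
open import Data.Vec.Properties using (≡-dec; toList-reverse)
open import Function using (_∘_; id)
open import Relation.Binary.Definitions using (DecidableEquality)
open import Relation.Binary.PropositionalEquality
open import Relation.Nullary using (¬_; Dec; yes; no)
open import Relation.Nullary.Decidable using (_×-dec_; _⊎-dec_)

bitValue : Bool → ℕ
bitValue true = 1
bitValue false = 0

wtL-∷ : ∀ b xs → wtL (b ∷ xs) ≡ bitValue b + wtL xs
wtL-∷ true xs = refl
wtL-∷ false xs = refl

wtL-++ : ∀ xs ys → wtL (xs ++ ys) ≡ wtL xs + wtL ys
wtL-++ [] ys = refl
wtL-++ (true ∷ xs) ys = cong suc (wtL-++ xs ys)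
wtL-++ (false ∷ xs) ys = wtL-++ xs ys

wtL-reverse : ∀ xs → wtL (List.reverse xs) ≡ wtL xs
wtL-reverse [] = refl
wtL-reverse (x ∷ xs) = begin
  wtL (List.reverse (x ∷ xs))  ≡⟨ cong wtL (unfold-reverse x xs) ⟩
  wtL (List.reverse xs ++ x ∷ [])  ≡⟨ wtL-++ (List.reverse xs) (x ∷ []) ⟩
  wtL (List.reverse xs) + wtL (x ∷ [])  ≡⟨ cong₂ _+_ (wtL-reverse xs) (trans (wtL-∷ x []) (+-identityʳ _)) ⟩
  wtL xs + bitValue x  ≡⟨ +-comm (wtL xs) (bitValue x) ⟩
  bitValue x + wtL xs  ≡⟨ wtL-∷ x xs ⟨
  wtL (x ∷ xs)  ∎
  where open ≡-Reasoning

wtL-take+wtL-drop : ∀ j xs → wtL (take j xs) + wtL (drop j xs) ≡ wtL xs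
wtL-take+wtL-drop j xs = trans (sym (wtL-++ (take j xs) (drop j xs))) (cong wtL (take++drop≡id j xs))

take-length-++ : ∀ {A : Set} (ys zs : List A) → take (length ys) (ys ++ zs) ≡ ys
take-length-++ [] zs = refl
take-length-++ (y ∷ ys) zs = cong (y ∷_) (take-length-++ ys zs)

wtL-take-reverse : ∀ xs j → j ≤ length xs → wtL (take j (List.reverse xs)) ≡ wtL (suffixL j xs)
wtL-take-reverse xs j j≤ = begin
  wtL (take j (List.reverse xs))
    ≡⟨ cong (λ z → wtL (take j (List.reverse z))) (sym (take++drop≡id k xs)) ⟩
  wtL (take j (List.reverse (take k xs ++ drop k xs)))
    ≡⟨ cong (wtL ∘ take j) (reverse-++ (take k xs) (drop k xs)) ⟩
  wtL (take j (List.reverse (drop k xs) ++ List.reverse (take k xs)))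
    ≡⟨ cong (λ i → wtL (take i (List.reverse (drop k xs) ++ List.reverse (take k xs)))) (sym length-suffix) ⟩
  wtL (take (length (List.reverse (drop k xs))) (List.reverse (drop k xs) ++ List.reverse (take k xs)))
    ≡⟨ cong wtL (take-length-++ (List.reverse (drop k xs)) (List.reverse (take k xs))) ⟩
  wtL (List.reverse (drop k xs))
    ≡⟨ wtL-reverse (drop k xs) ⟩
  wtL (drop k xs)  ∎
  where
  open ≡-Reasoning
  k = length xs ∸ j
  length-suffix : length (List.reverse (drop k xs)) ≡ j
  length-suffix = trans (length-reverse (drop k xs)) (trans (length-drop k xs) (m∸[m∸n]≡n j≤))

-- Strings with prescribed prefix weights

Step : (ℕ → ℕ) → ℕ → Set
Step p k = p (suc k) ≡ p k ⊎ p (suc k) ≡ suc (p k)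

bit : (ℕ → ℕ) → ℕ → Bool
bit p k = not (p (suc k) ≡ᵇ p k)

≡ᵇ-refl : ∀ a → (a ≡ᵇ a) ≡ true
≡ᵇ-refl zero = refl
≡ᵇ-refl (suc a) = ≡ᵇ-refl a

suc-≡ᵇ : ∀ a → (suc a ≡ᵇ a) ≡ false
suc-≡ᵇ zero = refl
suc-≡ᵇ (suc a) = suc-≡ᵇ a

step-bit : ∀ p k → Step p k → p (suc k) ≡ p k + bitValue (bit p k)
step-bit p k (inj₁ eq) rewrite eq | ≡ᵇ-refl (p k) = sym (+-identityʳ (p k))
step-bit p k (inj₂ eq) rewrite eq | suc-≡ᵇ (p k) = sym (+-comm (p k) 1)

vecUpTo : ∀ {A : Set} (k : ℕ) → (ℕ → A) → Vec A k
vecUpTo zero b = Vec.[]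
vecUpTo (suc k) b = b 0 Vec.∷ vecUpTo k (b ∘ suc)

toList-vecUpTo : ∀ {A : Set} k (b : ℕ → A) → toList (vecUpTo k b) ≡ applyUpTo b k
toList-vecUpTo zero b = refl
toList-vecUpTo (suc k) b = cong (b 0 ∷_) (toList-vecUpTo k (b ∘ suc))

stringOf : (n : ℕ) → (ℕ → ℕ) → BStr n
stringOf n p = vecUpTo n (bit p)

wtL-take-bits : ∀ k p → (∀ i → i < k → Step p i) →
  ∀ j → j ≤ k → p 0 + wtL (take j (applyUpTo (bit p) k)) ≡ p j
wtL-take-bits k p steps zero j≤k = +-identityʳ (p 0)
wtL-take-bits (suc k) p steps (suc j) (s≤s j≤k) = begin
  p 0 + wtL (bit p 0 ∷ take j (applyUpTo (bit (p ∘ suc)) k))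
    ≡⟨ cong (p 0 +_) (wtL-∷ (bit p 0) (take j (applyUpTo (bit (p ∘ suc)) k))) ⟩
  p 0 + (bitValue (bit p 0) + W)  ≡⟨ +-assoc (p 0) _ W ⟨
  p 0 + bitValue (bit p 0) + W  ≡⟨ cong (_+ W) (step-bit p 0 (steps 0 (s≤s z≤n))) ⟨
  p 1 + W  ≡⟨ wtL-take-bits k (p ∘ suc) (λ i i<k → steps (suc i) (s≤s i<k)) j j≤k ⟩
  p (suc j)  ∎
  where
  open ≡-Reasoning
  W = wtL (take j (applyUpTo (bit (p ∘ suc)) k))

-- p and q are the prefix and suffix weight functions of one string of length n and weight total.
record IsWeightProfile (n : ℕ) (p q : ℕ → ℕ) : Set where
  field
    total : ℕ
    prefix-zero : p 0 ≡ 0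
    suffix-zero : q 0 ≡ 0
    prefix-step : ∀ k → k < n → Step p k
    complement : ∀ l → l ≤ n → p l + q (n ∸ l) ≡ total

point : (ℕ → ℕ) → ℕ → ℕ × ℕ
point p l = (l ∸ p l , p l)

map-oneTo-cong : ∀ {A : Set} {F G : ℕ → A} n → (∀ j → j ≤ n → F j ≡ G j) → map F (oneTo n) ≡ map G (oneTo n)
map-oneTo-cong n eq = map-cong-local (map⁺ (applyUpTo⁺₁ id n (λ i<n → eq _ i<n)))

module _ {n : ℕ} {p q : ℕ → ℕ} (P : IsWeightProfile n p q) where
  open IsWeightProfile P

  private
    xs : List Bool
    xs = toList (stringOf n p)

    length-xs : length xs ≡ n
    length-xs = trans (cong length (toList-vecUpTo n (bit p))) (length-applyUpTo (bit p) n)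

  prefix-weight : ∀ j → j ≤ n → wtL (prefixL j (toList (stringOf n p))) ≡ p j
  prefix-weight j j≤n rewrite toList-vecUpTo n (bit p) =
    trans (cong (_+ wtL (take j (applyUpTo (bit p) n))) (sym prefix-zero)) (wtL-take-bits n p prefix-step j j≤n)

  prefix-weight-total : p n ≡ total
  prefix-weight-total = begin
    p n  ≡⟨ +-identityʳ (p n) ⟨
    p n + 0  ≡⟨ cong (p n +_) (trans (cong q (n∸n≡0 n)) suffix-zero) ⟨
    p n + q (n ∸ n)  ≡⟨ complement n ≤-refl ⟩
    total  ∎
    where open ≡-Reasoning

  suffix-weight : ∀ j → j ≤ n → wtL (suffixL j (toList (stringOf n p))) ≡ q j
  suffix-weight j j≤n = +-cancelˡ-≡ (p (n ∸ j)) _ _ (begin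
    p (n ∸ j) + wtL (drop (length xs ∸ j) xs)
      ≡⟨ cong (λ k → p (n ∸ j) + wtL (drop (k ∸ j) xs)) length-xs ⟩
    p (n ∸ j) + wtL (drop (n ∸ j) xs)
      ≡⟨ cong (_+ wtL (drop (n ∸ j) xs)) (prefix-weight (n ∸ j) (m∸n≤m n j)) ⟨
    wtL (take (n ∸ j) xs) + wtL (drop (n ∸ j) xs)  ≡⟨ wtL-take+wtL-drop (n ∸ j) xs ⟩
    wtL xs  ≡⟨ cong wtL (take-all n xs (≤-reflexive length-xs)) ⟨
    wtL (take n xs)  ≡⟨ prefix-weight n ≤-refl ⟩
    p n  ≡⟨ prefix-weight-total ⟩
    total  ≡⟨ complement (n ∸ j) (m∸n≤m n j) ⟨
    p (n ∸ j) + q (n ∸ (n ∸ j))  ≡⟨ cong (λ k → p (n ∸ j) + q k) (m∸[m∸n]≡n j≤n) ⟩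
    p (n ∸ j) + q j  ∎)
    where open ≡-Reasoning

  reverse-prefix-weight : ∀ j → j ≤ n → wtL (prefixL j (toList (reverse (stringOf n p)))) ≡ q j
  reverse-prefix-weight j j≤n rewrite toList-reverse (stringOf n p) =
    trans (wtL-take-reverse xs j (subst (j ≤_) (sym length-xs) j≤n)) (suffix-weight j j≤n)

  Mstr-stringOf : Mstr (stringOf n p) ≡ map (point p) (oneTo n) ++ map (point q) (oneTo n)
  Mstr-stringOf = cong₂ _++_
    (map-oneTo-cong n (λ j j≤n → cong (λ w → (j ∸ w , w)) (prefix-weight j j≤n)))
    (map-oneTo-cong n (λ j j≤n → cong (λ w → (j ∸ w , w)) (suffix-weight j j≤n)))

map-oneTo : ∀ {A : Set} (F : ℕ → A) k → map F (oneTo k) ≡ applyUpTo (F ∘ suc) k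
map-oneTo F k = trans (sym (map-∘ (upTo k))) (map-applyUpTo id (F ∘ suc) k)

Mset-applyUpTo : ∀ {n} (S : ℕ → BStr n) h → Mset (applyUpTo S h) ≡ concat (applyUpTo (Mstr ∘ S) h)
Mset-applyUpTo S h = cong concat (map-applyUpTo S Mstr h)

map-++-map-↭ : ∀ {A B : Set} (P Q C D : A → B) xs → (∀ x → P x ∷ Q x ∷ [] ↭ C x ∷ D x ∷ []) →
  map P xs ++ map Q xs ↭ map C xs ++ map D xs
map-++-map-↭ P Q C D [] pair = ↭-refl
map-++-map-↭ P Q C D (x ∷ xs) pair =
  ↭-trans (prep (P x) (shift (Q x) (map P xs) (map Q xs)))
  (↭-trans (++⁺ (pair x) (map-++-map-↭ P Q C D xs pair))
  (prep (C x) (↭-sym (shift (D x) (map C xs) (map D xs)))))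

concat-applyUpTo-pairs : ∀ {A : Set} (F T : ℕ → List A) h →
  (∀ i → i < h → T i ≡ F (2 * i) ++ F (suc (2 * i))) →
  concat (applyUpTo T h) ≡ concat (applyUpTo F (2 * h))
concat-applyUpTo-pairs F T zero pairs = refl
concat-applyUpTo-pairs F T (suc h) pairs = begin
  T 0 ++ concat (applyUpTo (T ∘ suc) h)
    ≡⟨ cong₂ _++_ (pairs 0 (s≤s z≤n)) (concat-applyUpTo-pairs (F ∘ suc ∘ suc) (T ∘ suc) h pairs′) ⟩
  (F 0 ++ F 1) ++ concat (applyUpTo (F ∘ suc ∘ suc) (2 * h))  ≡⟨ ++-assoc (F 0) (F 1) _ ⟩
  concat (applyUpTo F (2 + 2 * h))  ≡⟨ cong (concat ∘ applyUpTo F) (*-suc 2 h) ⟨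
  concat (applyUpTo F (2 * suc h))  ∎
  where
  open ≡-Reasoning
  pairs′ : ∀ i → i < h → T (suc i) ≡ F (2 + 2 * i) ++ F (3 + 2 * i)
  pairs′ i i<h = trans (pairs (suc i) (s≤s i<h)) (cong (λ k → F k ++ F (suc k)) (*-suc 2 i))

concat-applyUpTo-↭ : ∀ {A : Set} (F G : ℕ → List A) k → (∀ i → F i ↭ G i) →
  concat (applyUpTo F k) ↭ concat (applyUpTo G k)
concat-applyUpTo-↭ F G zero F↭G = ↭-refl
concat-applyUpTo-↭ F G (suc k) F↭G = ++⁺ (F↭G 0) (concat-applyUpTo-↭ (F ∘ suc) (G ∘ suc) k (F↭G ∘ suc))

replaceAt : ∀ {A : Set} → ℕ → A → (ℕ → A) → ℕ → A
replaceAt i c S k with k ≟ i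
... | yes _ = c
... | no _ = S k

Mset-replaceAt-↭ : ∀ {n} h i (c : BStr n) (S : ℕ → BStr n) → Mstr c ↭ Mstr (S i) →
  Mset (applyUpTo (replaceAt i c S) h) ↭ Mset (applyUpTo S h)
Mset-replaceAt-↭ h i c S c↭ =
  ↭-trans (↭-reflexive (Mset-applyUpTo (replaceAt i c S) h))
  (↭-trans (concat-applyUpTo-↭ (Mstr ∘ replaceAt i c S) (Mstr ∘ S) h pointwise)
  (↭-reflexive (sym (Mset-applyUpTo S h))))
  where
  pointwise : ∀ k → Mstr (replaceAt i c S k) ↭ Mstr (S k)
  pointwise k with k ≟ i
  ... | yes refl = c↭
  ... | no _ = ↭-refl

pairCount : ∀ {n} → BStr n → List (BStr n) → ℕ
pairCount t L = mult t L + mult (reverse t) L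

mult-∷ : ∀ {n} (u x : BStr n) L → mult u (x ∷ L) ≡ mult u (x ∷ []) + mult u L
mult-∷ u x L with ≡-dec _≟B_ x u
... | yes _ = refl
... | no _ = refl

pairCount-∷ : ∀ {n} (t x : BStr n) L → pairCount t (x ∷ L) ≡ pairCount t (x ∷ []) + pairCount t L
pairCount-∷ t x L = trans (cong₂ _+_ (mult-∷ t x L) (mult-∷ (reverse t) x L))
  (interchange (mult t (x ∷ [])) (mult t L) (mult (reverse t) (x ∷ [])) (mult (reverse t) L))

pairCount-self : ∀ {n} (t : BStr n) → 1 ≤ pairCount t (t ∷ [])
pairCount-self t with ≡-dec _≟B_ t t
... | yes _ = s≤s z≤n
... | no t≢t = ⊥-elim (t≢t refl)

pairCount-other : ∀ {n} (t c : BStr n) → c ≢ t → c ≢ reverse t → pairCount t (c ∷ []) ≡ 0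
pairCount-other t c c≢t c≢rt with ≡-dec _≟B_ c t | ≡-dec _≟B_ c (reverse t)
... | yes c≡t | _ = ⊥-elim (c≢t c≡t)
... | no _ | yes c≡rt = ⊥-elim (c≢rt c≡rt)
... | no _ | no _ = refl

pairCount-applyUpTo-≤ : ∀ {n} (t : BStr n) (T S : ℕ → BStr n) h →
  (∀ k → pairCount t (T k ∷ []) ≤ pairCount t (S k ∷ [])) →
  pairCount t (applyUpTo T h) ≤ pairCount t (applyUpTo S h)
pairCount-applyUpTo-≤ t T S zero le = z≤n
pairCount-applyUpTo-≤ t T S (suc h) le =
  subst₂ _≤_ (sym (pairCount-∷ t (T 0) (applyUpTo (T ∘ suc) h))) (sym (pairCount-∷ t (S 0) (applyUpTo (S ∘ suc) h)))
    (+-mono-≤ (le 0) (pairCount-applyUpTo-≤ t (T ∘ suc) (S ∘ suc) h (le ∘ suc)))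

pairCount-applyUpTo-< : ∀ {n} (t : BStr n) (T S : ℕ → BStr n) h →
  (∀ k → pairCount t (T k ∷ []) ≤ pairCount t (S k ∷ [])) →
  ∀ i → i < h → pairCount t (T i ∷ []) < pairCount t (S i ∷ []) →
  pairCount t (applyUpTo T h) < pairCount t (applyUpTo S h)
pairCount-applyUpTo-< t T S (suc h) le zero _ lt =
  subst₂ _<_ (sym (pairCount-∷ t (T 0) (applyUpTo (T ∘ suc) h))) (sym (pairCount-∷ t (S 0) (applyUpTo (S ∘ suc) h)))
    (+-mono-<-≤ lt (pairCount-applyUpTo-≤ t (T ∘ suc) (S ∘ suc) h (le ∘ suc)))
pairCount-applyUpTo-< t T S (suc h) le (suc i) (s≤s i<h) lt =
  subst₂ _<_ (sym (pairCount-∷ t (T 0) (applyUpTo (T ∘ suc) h))) (sym (pairCount-∷ t (S 0) (applyUpTo (S ∘ suc) h)))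
    (+-mono-≤-< (le 0) (pairCount-applyUpTo-< t (T ∘ suc) (S ∘ suc) h (le ∘ suc) i i<h lt))

-- ∼ preserves the number of copies of S i and its reversal, which the replacement lowers.
replaceAt-≁ : ∀ {n} h i (c : BStr n) (S : ℕ → BStr n) → i < h → c ≢ S i → c ≢ reverse (S i) →
  ¬ (applyUpTo (replaceAt i c S) h ∼ applyUpTo S h)
replaceAt-≁ h i c S i<h c≢t c≢rt (_ , same) =
  <-irrefl (sym (same (S i) (∈-applyUpTo⁺ S i<h)))
    (pairCount-applyUpTo-< (S i) (replaceAt i c S) S h pointwise i i<h replaced)
  where
  c-absent : pairCount (S i) (c ∷ []) ≡ 0
  c-absent = pairCount-other (S i) c c≢t c≢rt

  pointwise : ∀ k → pairCount (S i) (replaceAt i c S k ∷ []) ≤ pairCount (S i) (S k ∷ [])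
  pointwise k with k ≟ i
  ... | yes refl = subst (_≤ pairCount (S i) (S i ∷ [])) (sym c-absent) z≤n
  ... | no _ = ≤-refl

  replaced : pairCount (S i) (replaceAt i c S i ∷ []) < pairCount (S i) (S i ∷ [])
  replaced with i ≟ i
  ... | yes _ = subst (_< pairCount (S i) (S i ∷ [])) (sym c-absent) (pairCount-self (S i))
  ... | no i≢i = ⊥-elim (i≢i refl)

-- Maximal intervals between two complementary columns

column : (ℕ → ℕ → ℕ) → ℕ → ℕ → ℕ
column f m l = f l m

MaxInterval-sym : ∀ {n f a b k₁ k₂} → MaxInterval n f a b k₁ k₂ → MaxInterval n f b a k₁ k₂
MaxInterval-sym {n} {f} (1≤k₁ , k₁≤k₂ , k₂≤n , inside , left , right) =
  1≤k₁ , k₁≤k₂ , k₂≤n , (λ l p q → flip (inside l p q)) , left ∘ flip , right ∘ flip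
  where
  flip : ∀ {m₁ m₂ l} → InD n f m₁ m₂ l → InD n f m₂ m₁ l
  flip (1≤l , l≤n , ne) = 1≤l , l≤n , ne ∘ sym

interval-exit : ∀ {a i b} → a ≤ i → i ≤ b → ¬ (a ≤ suc i × suc i ≤ b) → i ≡ b
interval-exit a≤i i≤b ¬next with m≤n⇒m<n∨m≡n i≤b
... | inj₁ i<b = ⊥-elim (¬next (m≤n⇒m≤1+n a≤i , i<b))
... | inj₂ i≡b = i≡b

interval-entry : ∀ {a i b} → a ≤ suc i → suc i ≤ b → ¬ (a ≤ i × i ≤ b) → suc i ≡ a
interval-entry {i = i} a≤1+i 1+i≤b ¬prev with m≤n⇒m<n∨m≡n a≤1+i
... | inj₁ a<1+i = ⊥-elim (¬prev (≤-pred a<1+i , ≤-trans (n≤1+n i) 1+i≤b))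
... | inj₂ a≡1+i = sym a≡1+i

suc[m∸n]≡m∸[n∸1] : ∀ {m n} → 1 ≤ n → n ≤ m → suc (m ∸ n) ≡ m ∸ (n ∸ 1)
suc[m∸n]≡m∸[n∸1] {n = suc n} _ n<m = sym (+-∸-assoc 1 n<m)

module MaximalIntervals {n : ℕ} {f : ℕ → ℕ → ℕ} {o e : ℕ}
  (P : IsWeightProfile n (column f o) (column f e))
  (e-step : ∀ k → k < n → Step (column f e) k) where

  open IsWeightProfile P

  Agree : ℕ → Set
  Agree l = f l o ≡ f l e

  Differ : ℕ → Set
  Differ = InD n f o e

  Maximal : ℕ → ℕ → Set
  Maximal = MaxInterval n f o e

  complement-swapped : ∀ l → l ≤ n → f l e + f (n ∸ l) o ≡ total
  complement-swapped l l≤n = begin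
    f l e + f (n ∸ l) o  ≡⟨ +-comm (f l e) _ ⟩
    f (n ∸ l) o + f l e  ≡⟨ cong (λ k → f (n ∸ l) o + f k e) (m∸[m∸n]≡n l≤n) ⟨
    f (n ∸ l) o + f (n ∸ (n ∸ l)) e  ≡⟨ complement (n ∸ l) (m∸n≤m n l) ⟩
    total  ∎
    where open ≡-Reasoning

  agree-mirror : ∀ l → l ≤ n → Agree l → Agree (n ∸ l)
  agree-mirror l l≤n agree = +-cancelˡ-≡ (f l o) _ _ (begin
    f l o + f (n ∸ l) o  ≡⟨ cong (_+ f (n ∸ l) o) agree ⟩
    f l e + f (n ∸ l) o  ≡⟨ complement-swapped l l≤n ⟩
    total  ≡⟨ complement l l≤n ⟨
    f l o + f (n ∸ l) e  ∎)
    where open ≡-Reasoning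

  agree-mirror⁻ : ∀ l → l ≤ n → Agree (n ∸ l) → Agree l
  agree-mirror⁻ l l≤n agree = subst Agree (m∸[m∸n]≡n l≤n) (agree-mirror (n ∸ l) (m∸n≤m n l) agree)

  agree-n : Agree n
  agree-n = agree-mirror 0 z≤n (trans prefix-zero (sym suffix-zero))

  ¬differ⇒agree : ∀ l → l ≤ n → ¬ Differ l → Agree l
  ¬differ⇒agree zero _ _ = trans prefix-zero (sym suffix-zero)
  ¬differ⇒agree (suc k) l≤n ¬differ with f (suc k) o ≟ f (suc k) e
  ... | yes agree = agree
  ... | no ne = ⊥-elim (¬differ (s≤s z≤n , l≤n , ne))

  differ⇒<n : ∀ {l} → Differ l → l < n
  differ⇒<n (_ , l≤n , ne) = ≤∧≢⇒< l≤n (λ { refl → ne agree-n })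

  differ-mirror : ∀ {l} → Differ l → Differ (n ∸ l)
  differ-mirror {l} differ@(_ , l≤n , ne) =
    m<n⇒0<n∸m (differ⇒<n differ) , m∸n≤m n l , ne ∘ agree-mirror⁻ l l≤n

  ¬differ-mirror : ∀ {l} → l ≤ n → ¬ Differ l → ¬ Differ (n ∸ l)
  ¬differ-mirror l≤n ¬differ differ = ¬differ (subst Differ (m∸[m∸n]≡n l≤n) (differ-mirror differ))

  maximal-mirror : ∀ {a b} → Maximal a b → Maximal (n ∸ b) (n ∸ a)
  maximal-mirror {a} {b} (1≤a , a≤b , b≤n , inside , left , right) =
    m<n⇒0<n∸m b<n , ∸-monoʳ-≤ n a≤b , m∸n≤m n a , inside′ , left′ , right′
    where
    b<n : b < n
    b<n = differ⇒<n (inside b a≤b ≤-refl)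
    a≤n = ≤-trans a≤b b≤n

    inside′ : ∀ l → n ∸ b ≤ l → l ≤ n ∸ a → Differ l
    inside′ l p q = subst Differ (m∸[m∸n]≡n l≤n) (differ-mirror (inside (n ∸ l)
      (subst (_≤ n ∸ l) (m∸[m∸n]≡n a≤n) (∸-monoʳ-≤ n q))
      (subst (n ∸ l ≤_) (m∸[m∸n]≡n b≤n) (∸-monoʳ-≤ n p))))
      where l≤n = ≤-trans q (m∸n≤m n a)

    left′ : ¬ Differ (n ∸ b ∸ 1)
    left′ = subst (¬_ ∘ Differ) (sym (trans (∸-+-assoc n b 1) (cong (n ∸_) (+-comm b 1))))
      (¬differ-mirror b<n right)

    right′ : ¬ Differ (suc (n ∸ a))
    right′ = subst (¬_ ∘ Differ) (sym (suc[m∸n]≡m∸[n∸1] 1≤a a≤n))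
      (¬differ-mirror (≤-trans (m∸n≤m a 1) a≤n) left)

  maximal-overlap : ∀ {a b a′ b′ x} → Maximal a b → Maximal a′ b′ →
    a ≤ x → x ≤ b → a′ ≤ x → x ≤ b′ → (a , b) ≡ (a′ , b′)
  maximal-overlap {a} {b} {a′} {b′} I I′ a≤x x≤b a′≤x x≤b′ =
    cong₂ _,_ (≤-antisym (≮⇒≥ (¬left< I′ I a′≤x x≤b′ a≤x)) (≮⇒≥ (¬left< I I′ a≤x x≤b a′≤x)))
              (≤-antisym (≮⇒≥ (¬right< I′ I x≤b′ a≤x x≤b)) (≮⇒≥ (¬right< I I′ x≤b a′≤x x≤b′)))
    where
    ¬left< : ∀ {a b a′ b′ x} → Maximal a b → Maximal a′ b′ → a ≤ x → x ≤ b → a′ ≤ x → ¬ (a < a′)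
    ¬left< {a′ = a′} (_ , _ , _ , inside , _ , _) (_ , _ , _ , _ , left′ , _) a≤x x≤b a′≤x a<a′ =
      left′ (inside (a′ ∸ 1) (<⇒≤pred a<a′) (≤-trans (m∸n≤m a′ 1) (≤-trans a′≤x x≤b)))

    ¬right< : ∀ {a b a′ b′ x} → Maximal a b → Maximal a′ b′ → x ≤ b → a′ ≤ x → x ≤ b′ → ¬ (b < b′)
    ¬right< {b = b} (_ , _ , _ , _ , _ , right) (_ , _ , _ , inside′ , _ , _) x≤b a′≤x x≤b′ b<b′ =
      right (inside′ (suc b) (≤-trans a′≤x (≤-trans x≤b (n≤1+n b))) b<b′)

  -- Exchanging the two columns on a maximal interval and on its mirror image.
  module Exchange {a₁ b₁ : ℕ} (I₁ : Maximal a₁ b₁) where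
    private
      a₁≤b₁ : a₁ ≤ b₁
      a₁≤b₁ = proj₁ (proj₂ I₁)
      b₁≤n : b₁ ≤ n
      b₁≤n = proj₁ (proj₂ (proj₂ I₁))
      a₁≤n : a₁ ≤ n
      a₁≤n = ≤-trans a₁≤b₁ b₁≤n
      inside₁ : ∀ l → a₁ ≤ l → l ≤ b₁ → Differ l
      inside₁ = proj₁ (proj₂ (proj₂ (proj₂ I₁)))
      b₁<n : b₁ < n
      b₁<n = differ⇒<n (inside₁ b₁ a₁≤b₁ ≤-refl)
      agree-before : Agree (a₁ ∸ 1)
      agree-before = ¬differ⇒agree (a₁ ∸ 1) (≤-trans (m∸n≤m a₁ 1) a₁≤n) (proj₁ (proj₂ (proj₂ (proj₂ (proj₂ I₁)))))
      agree-after : Agree (suc b₁)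
      agree-after = ¬differ⇒agree (suc b₁) b₁<n (proj₂ (proj₂ (proj₂ (proj₂ (proj₂ I₁)))))

    Region : ℕ → Set
    Region l = (a₁ ≤ l × l ≤ b₁) ⊎ (n ∸ b₁ ≤ l × l ≤ n ∸ a₁)

    region? : ∀ l → Dec (Region l)
    region? l = (a₁ ≤? l ×-dec l ≤? b₁) ⊎-dec (n ∸ b₁ ≤? l ×-dec l ≤? n ∸ a₁)

    region-mirror : ∀ l → l ≤ n → Region l → Region (n ∸ l)
    region-mirror l l≤n (inj₁ (p , q)) = inj₂ (∸-monoʳ-≤ n q , ∸-monoʳ-≤ n p)
    region-mirror l l≤n (inj₂ (p , q)) =
      inj₁ (subst (_≤ n ∸ l) (m∸[m∸n]≡n a₁≤n) (∸-monoʳ-≤ n q) ,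
            subst (n ∸ l ≤_) (m∸[m∸n]≡n b₁≤n) (∸-monoʳ-≤ n p))

    region-mirror⁻ : ∀ l → l ≤ n → Region (n ∸ l) → Region l
    region-mirror⁻ l l≤n r = subst Region (m∸[m∸n]≡n l≤n) (region-mirror (n ∸ l) (m∸n≤m n l) r)

    g : ℕ → ℕ
    g l with region? l
    ... | yes _ = f l e
    ... | no _ = f l o

    g′ : ℕ → ℕ
    g′ l with region? l
    ... | yes _ = f l o
    ... | no _ = f l e

    g-zero : g 0 ≡ 0
    g-zero with region? 0
    ... | yes _ = suffix-zero
    ... | no _ = prefix-zero

    g′-zero : g′ 0 ≡ 0
    g′-zero with region? 0
    ... | yes _ = prefix-zero
    ... | no _ = suffix-zero

    g-complement : ∀ l → l ≤ n → g l + g′ (n ∸ l) ≡ total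
    g-complement l l≤n with region? l | region? (n ∸ l)
    ... | yes _ | yes _ = complement-swapped l l≤n
    ... | no _ | no _ = complement l l≤n
    ... | yes r | no ¬r′ = ⊥-elim (¬r′ (region-mirror l l≤n r))
    ... | no ¬r | yes r′ = ⊥-elim (¬r (region-mirror⁻ l l≤n r′))

    -- The region is bounded by points where the columns agree, so g still moves in unit steps.
    exit-agree : ∀ i → Region i → ¬ Region (suc i) → Agree (suc i)
    exit-agree i (inj₁ (p , q)) ¬next =
      subst Agree (cong suc (sym (interval-exit p q (¬next ∘ inj₁)))) agree-after
    exit-agree i (inj₂ (p , q)) ¬next =
      subst Agree (trans (sym (suc[m∸n]≡m∸[n∸1] (proj₁ I₁) a₁≤n)) (cong suc (sym (interval-exit p q (¬next ∘ inj₂)))))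
        (agree-mirror (a₁ ∸ 1) (≤-trans (m∸n≤m a₁ 1) a₁≤n) agree-before)

    entry-agree : ∀ i → ¬ Region i → Region (suc i) → Agree i
    entry-agree i ¬prev (inj₁ (p , q)) =
      subst Agree (cong (_∸ 1) (sym (interval-entry p q (¬prev ∘ inj₁)))) agree-before
    entry-agree i ¬prev (inj₂ (p , q)) =
      subst Agree (trans (sym (pred[m∸n]≡m∸[1+n] n b₁)) (cong pred (sym (interval-entry p q (¬prev ∘ inj₂)))))
        (agree-mirror (suc b₁) b₁<n agree-after)

    g-step : ∀ i → i < n → Step g i
    g-step i i<n with region? i | region? (suc i)
    ... | yes _ | yes _ = e-step i i<n
    ... | no _ | no _ = prefix-step i i<n
    ... | yes r | no ¬r′ = subst (λ x → x ≡ f i e ⊎ x ≡ suc (f i e)) (sym (exit-agree i r ¬r′)) (e-step i i<n)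
    ... | no ¬r | yes r′ = subst (λ x → f (suc i) e ≡ x ⊎ f (suc i) e ≡ suc x) (sym (entry-agree i ¬r r′)) (e-step i i<n)

    exchanged : IsWeightProfile n g g′
    exchanged = record
      { total = total ; prefix-zero = g-zero ; suffix-zero = g′-zero
      ; prefix-step = g-step ; complement = g-complement }

    point-swap : ∀ l → point g l ∷ point g′ l ∷ [] ↭ point (column f o) l ∷ point (column f e) l ∷ []
    point-swap l with region? l
    ... | yes _ = swap (point (column f e) l) (point (column f o) l) ↭-refl
    ... | no _ = ↭-refl

    g-a₁ : g a₁ ≢ f a₁ o
    g-a₁ with region? a₁
    ... | yes _ = proj₂ (proj₂ (inside₁ a₁ ≤-refl a₁≤b₁)) ∘ sym
    ... | no ¬r = ⊥-elim (¬r (inj₁ (≤-refl , a₁≤b₁)))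

    g-outside : ∀ {a b} → Maximal a b → (a , b) ≢ (a₁ , b₁) → (a , b) ≢ (n ∸ b₁ , n ∸ a₁) → g a ≢ f a e
    g-outside {a} I@(_ , a≤b , _ , inside , _) ≢I₁ ≢I₁′ with region? a
    ... | yes (inj₁ (p , q)) = ⊥-elim (≢I₁ (maximal-overlap I I₁ ≤-refl a≤b p q))
    ... | yes (inj₂ (p , q)) = ⊥-elim (≢I₁′ (maximal-overlap I (maximal-mirror I₁) ≤-refl a≤b p q))
    ... | no _ = proj₂ (proj₂ (inside a ≤-refl a≤b))

  exchange-string : ∀ {a₁ b₁ a b} → Maximal a₁ b₁ → Maximal a b →
    (a , b) ≢ (a₁ , b₁) → (a , b) ≢ (n ∸ b₁ , n ∸ a₁) →
    let t = stringOf n (column f o) in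
    Σ (BStr n) λ c → Mstr c ↭ Mstr t × c ≢ t × c ≢ reverse t
  exchange-string {a₁} {b₁} {a} {b} I₁ I ≢I₁ ≢I₁′ = stringOf n g , same-points , ≢t , ≢reverse-t
    where
    open Exchange I₁
    t = stringOf n (column f o)

    same-points : Mstr (stringOf n g) ↭ Mstr t
    same-points =
      ↭-trans (↭-reflexive (Mstr-stringOf exchanged))
      (↭-trans (map-++-map-↭ (point g) (point g′) (point (column f o)) (point (column f e)) (oneTo n) point-swap)
      (↭-reflexive (sym (Mstr-stringOf P))))

    a₁≤n : a₁ ≤ n
    a₁≤n = ≤-trans (proj₁ (proj₂ I₁)) (proj₁ (proj₂ (proj₂ I₁)))

    a≤n : a ≤ n
    a≤n = ≤-trans (proj₁ (proj₂ I)) (proj₁ (proj₂ (proj₂ I)))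

    ≢t : stringOf n g ≢ t
    ≢t eq = g-a₁ (begin
      g a₁  ≡⟨ prefix-weight exchanged a₁ a₁≤n ⟨
      wtL (prefixL a₁ (toList (stringOf n g)))  ≡⟨ cong (wtL ∘ prefixL a₁ ∘ toList) eq ⟩
      wtL (prefixL a₁ (toList t))  ≡⟨ prefix-weight P a₁ a₁≤n ⟩
      f a₁ o  ∎)
      where open ≡-Reasoning

    ≢reverse-t : stringOf n g ≢ reverse t
    ≢reverse-t eq = g-outside I ≢I₁ ≢I₁′ (begin
      g a  ≡⟨ prefix-weight exchanged a a≤n ⟨
      wtL (prefixL a (toList (stringOf n g)))  ≡⟨ cong (wtL ∘ prefixL a ∘ toList) eq ⟩
      wtL (prefixL a (toList (reverse t)))  ≡⟨ reverse-prefix-weight P a a≤n ⟩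
      f a e  ∎)
      where open ≡-Reasoning

-- Solutions and the strings they determine

cwf-step : ∀ {n h f m} → IsCWF n h f → 1 ≤ m → m ≤ 2 * h → ∀ k → k < n → Step (column f m) k
cwf-step (_ , _ , steps , _) 1≤m m≤2h k k<n = steps (suc k) _ (s≤s z≤n) k<n 1≤m m≤2h

2+2*i≤2*h : ∀ {i h} → i < h → suc (suc (2 * i)) ≤ 2 * h
2+2*i≤2*h {i} {h} i<h = subst (_≤ 2 * h) (*-suc 2 i) (*-monoʳ-≤ 2 i<h)

cwf-profile : ∀ {n h f i} → IsCWF n h f → i < h →
  IsWeightProfile n (column f (suc (2 * i))) (column f (suc (suc (2 * i))))
cwf-profile {n} {h} {f} {i} cwf@(_ , starts-at-zero , _ , complementary) i<h = record
  { total = proj₁ columns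
  ; prefix-zero = starts-at-zero _ (s≤s z≤n) (<⇒≤ (2+2*i≤2*h i<h))
  ; suffix-zero = starts-at-zero _ (s≤s z≤n) (2+2*i≤2*h i<h)
  ; prefix-step = cwf-step cwf (s≤s z≤n) (<⇒≤ (2+2*i≤2*h i<h))
  ; complement = λ l l≤n →
      subst (λ k → f l (k ∸ 1) + f (n ∸ l) k ≡ proj₁ columns) (*-suc 2 i) (proj₂ columns l l≤n)
  }
  where columns = complementary (suc i) (s≤s z≤n) i<h

cwfString : (n : ℕ) → (ℕ → ℕ → ℕ) → ℕ → BStr n
cwfString n f i = stringOf n (column f (suc (2 * i)))

Mset-cwfString : ∀ {n h f} → IsCWF n h f → Mset (applyUpTo (cwfString n f) h) ≡ cwfMultiset n h f
Mset-cwfString {n} {h} {f} cwf = begin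
  Mset (applyUpTo (cwfString n f) h)  ≡⟨ Mset-applyUpTo (cwfString n f) h ⟩
  concat (applyUpTo (Mstr ∘ cwfString n f) h)
    ≡⟨ concat-applyUpTo-pairs columnPoints (Mstr ∘ cwfString n f) h (λ i i<h → Mstr-stringOf (cwf-profile cwf i<h)) ⟩
  concat (applyUpTo columnPoints (2 * h))  ≡⟨ cong concat (map-oneTo _ (2 * h)) ⟨
  cwfMultiset n h f  ∎
  where
  open ≡-Reasoning
  columnPoints : ℕ → List (ℕ × ℕ)
  columnPoints k = map (point (column f (suc k))) (oneTo n)

ColumnPair : ℕ → ℕ → Set
ColumnPair m i = (m ≡ 1 + 2 * i × star m ≡ 2 + 2 * i) ⊎ (m ≡ 2 + 2 * i × star m ≡ 1 + 2 * i)

star-suc-suc : ∀ m → 1 ≤ m → star (2 + m) ≡ 2 + star m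
star-suc-suc (suc m) _ with isEven (suc m)
... | true = refl
... | false = refl

2+-shift : ∀ j i {x} → x ≡ j + 2 * i → 2 + x ≡ j + 2 * suc i
2+-shift j i eq = trans (cong (2 +_) eq) (trans (x∙yz≈y∙xz 2 j (2 * i)) (cong (j +_) (sym (*-suc 2 i))))

column-pair : ∀ m → 1 ≤ m → ∃ (ColumnPair m)
column-pair 1 _ = 0 , inj₁ (refl , refl)
column-pair 2 _ = 0 , inj₂ (refl , refl)
column-pair (suc (suc (suc m))) _ with column-pair (suc m) (s≤s z≤n)
... | i , inj₁ (m≡ , m*≡) =
  suc i , inj₁ (2+-shift 1 i m≡ , trans (star-suc-suc (suc m) (s≤s z≤n)) (2+-shift 2 i m*≡))
... | i , inj₂ (m≡ , m*≡) =
  suc i , inj₂ (2+-shift 2 i m≡ , trans (star-suc-suc (suc m) (s≤s z≤n)) (2+-shift 1 i m*≡))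

column-pair-< : ∀ {m} i h → ColumnPair m i → m ≤ 2 * h → i < h
column-pair-< _ _ (inj₁ (refl , _)) m≤2h = *-cancelˡ-< 2 _ _ m≤2h
column-pair-< _ _ (inj₂ (refl , _)) m≤2h = *-cancelˡ-< 2 _ _ (≤-trans (n≤1+n _) m≤2h)

column-pair-maximal : ∀ {n f m i k₁ k₂} → ColumnPair m i → MaxInterval n f m (star m) k₁ k₂ →
  MaxInterval n f (1 + 2 * i) (2 + 2 * i) k₁ k₂
column-pair-maximal {n} {f} {i = i} {k₁} {k₂} (inj₁ (refl , star≡)) I =
  subst (λ x → MaxInterval n f (1 + 2 * i) x k₁ k₂) star≡ I
column-pair-maximal {n} {f} {i = i} {k₁} {k₂} (inj₂ (refl , star≡)) I =
  MaxInterval-sym {n} {f} (subst (λ x → MaxInterval n f (2 + 2 * i) x k₁ k₂) star≡ I)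

avoid-two : ∀ {A : Set} → DecidableEquality A → (P : A → Set) {x₁ x₂ x₃ : A} →
  P x₂ → P x₃ → x₁ ≢ x₂ → x₁ ≢ x₃ → x₂ ≢ x₃ → (y : A) → Σ A λ x → P x × x ≢ x₁ × x ≢ y
avoid-two dec P {x₂ = x₂} p₂ p₃ x₁≢x₂ x₁≢x₃ x₂≢x₃ y with dec x₂ y
... | yes refl = _ , p₃ , x₁≢x₃ ∘ sym , x₂≢x₃ ∘ sym
... | no x₂≢y = _ , p₂ , x₁≢x₂ ∘ sym , x₂≢y

non-unique-solution : ∀ {n h} {H : List (BStr n)} {f : ℕ → ℕ → ℕ} → IsCWF n h f → cwfMultiset n h f ↭ Mset H →
  ∀ i → i < h → ∀ {a₁ b₁ a₂ b₂ a₃ b₃} →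
  let Maximal = MaxInterval n f (1 + 2 * i) (2 + 2 * i) in
  Maximal a₁ b₁ → Maximal a₂ b₂ → Maximal a₃ b₃ →
  (a₁ , b₁) ≢ (a₂ , b₂) → (a₁ , b₁) ≢ (a₃ , b₃) → (a₂ , b₂) ≢ (a₃ , b₃) →
  Σ (List (BStr n)) λ U → Σ (List (BStr n)) λ V → Mset U ↭ Mset H × Mset V ↭ Mset H × ¬ (V ∼ U)
non-unique-solution {n} {h} {H} {f} cwf solution i i<h {a₁} {b₁} I₁ I₂ I₃ d₁₂ d₁₃ d₂₃
  with avoid-two (×-≡-dec _≟_ _≟_) (λ (a , b) → MaxInterval n f (1 + 2 * i) (2 + 2 * i) a b)
         I₂ I₃ d₁₂ d₁₃ d₂₃ (n ∸ b₁ , n ∸ a₁)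
... | (a , b) , I , ≢I₁ , ≢I₁′
  with MaximalIntervals.exchange-string {n} {f} {1 + 2 * i} {2 + 2 * i} (cwf-profile {i = i} cwf i<h)
         (cwf-step cwf (s≤s z≤n) (2+2*i≤2*h {i} i<h)) I₁ I ≢I₁ ≢I₁′
... | c , c↭t , c≢t , c≢rt =
  U , applyUpTo (replaceAt i c S) h , U-solves ,
  ↭-trans (Mset-replaceAt-↭ h i c S c↭t) U-solves , replaceAt-≁ h i c S i<h c≢t c≢rt
  where
  S = cwfString n f
  U = applyUpTo S h
  U-solves : Mset U ↭ Mset H
  U-solves = ↭-trans (↭-reflexive (Mset-cwfString cwf)) solution

lemma1 : (n h w̄ : ℕ) → 1 ≤ n → 1 ≤ h → w̄ ≤ n →
  (H : List (BStr n)) → length H ≡ h → All (λ t → wt t ≡ w̄) H →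
  (f : ℕ → ℕ → ℕ) → IsCWF n h f → cwfMultiset n h f ↭ Mset H →
  (m : ℕ) → 1 ≤ m → m ≤ 2 * h →
  (∃ λ a₁ → ∃ λ b₁ → ∃ λ a₂ → ∃ λ b₂ → ∃ λ a₃ → ∃ λ b₃ →
    MaxInterval n f m (star m) a₁ b₁ × MaxInterval n f m (star m) a₂ b₂
    × MaxInterval n f m (star m) a₃ b₃
    × (a₁ , b₁) ≢ (a₂ , b₂) × (a₁ , b₁) ≢ (a₃ , b₃) × (a₂ , b₂) ≢ (a₃ , b₃)) →
  Σ (List (BStr n)) λ U → Σ (List (BStr n)) λ V →
    Mset U ↭ Mset H × Mset V ↭ Mset H × ¬ (V ∼ U)
-- Only the solution f and the three intervals matter.
lemma1 n h _ _ _ _ H _ _ f cwf solution m 1≤m m≤2h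
  (a₁ , b₁ , a₂ , b₂ , a₃ , b₃ , I₁ , I₂ , I₃ , d₁₂ , d₁₃ , d₂₃)
  with column-pair m 1≤m
... | i , pair =
  non-unique-solution {H = H} cwf solution i (column-pair-< i h pair m≤2h)
    (orient I₁) (orient I₂) (orient I₃) d₁₂ d₁₃ d₂₃
  where
  orient : ∀ {k₁ k₂} → MaxInterval n f m (star m) k₁ k₂ → MaxInterval n f (1 + 2 * i) (2 + 2 * i) k₁ k₂
  orient = column-pair-maximal {n} {f} {i = i} pair
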